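{- Let $k\ge r\ge3$, $m\ge0$ and $N_2\geq 0$, and let $\pi\in\mathbb{E}(k,r)$ be such that exactly $N_2$ parts are marked with $2$ in $GG(\pi)$. Then $\pi\in\mathbb{C}_{<}(k,r|m)$ if and only if $m\geq N_2$.
   Context: A partition is a finite non-increasing sequence of positive integers. $\mathbb{C}(k,r)$ is the set of partitions $\pi=(\pi_1,\dots,\pi_\ell)$ with no repeated odd part, $\pi_i\ge\pi_{i+k-1}+2$ for $1\le i\le\ell-k+1$ (strict if $\pi_i$ even), and at most $r-1$ parts $\le2$. $\mathbb{E}(k,r)$ is the set of partitions in $\mathbb{C}(k,r)$ with no odd parts. Göllnitz–Gordon marking $GG(\pi)$: marks (positive integers) are assigned to the parts from smallest to largest, each as small as possible subject to: the mark of $\pi_i$ differs from the marks of all parts $\pi_g$, $g>i$, with $\pi_i-\pi_g\le2$ (strict if $\pi_i$ odd). A "$j$-marked $x$" is a part $x$ with mark $j$. $N_j$ is the number of $j$-marked parts and $\pi^{(j)}_1>\cdots>\pi^{(j)}_{N_j}$ are these parts; $\pi^{(j)}_0=+\infty$, $\pi^{(j)}_{N_j+1}=-\infty$. Starting types (for $N_2\ge1$): let $l$ be the largest integer $0\le l\le N_2$ such that no odd part of $\pi$ is $\ge\pi^{(2)}_l$; parts $\pi^{(2)}_i$, $i>l$, are of type $s_{ -1}$. For $b=1$: $\pi^{(2)}_1$ is of type $s_0$ [resp. $s_1$] with $s_1(\pi)=\pi^{(2)}_1-1$ [resp. $-2$] if there is a 1-marked $\pi^{(2)}_1-1$ [resp.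 $\pi^{(2)}_1-2$] and $\pi^{(2)}_1+2$ does not occur; of type $s_2$ ($s_1(\pi)=\pi^{(2)}_1+2$) if there is a 1-marked $\pi^{(2)}_1+2$; of type $s_3$ ($s_1(\pi)=\pi^{(2)}_1$) if there is a 1-marked $\pi^{(2)}_1$. For $b=2,\dots,l$: type $s_0$ [resp. $s_1$], $s_b(\pi)=\pi^{(2)}_b-1$ [resp. $-2$], if there is a 1-marked $\pi^{(2)}_b-1$ [resp. $-2$] and, whenever a 1-marked $\pi^{(2)}_b+2$ exists, $s_{b-1}(\pi)=\pi^{(2)}_b+2$; type $s_2$ ($s_b(\pi)=\pi^{(2)}_b+2$) if there is a 1-marked $\pi^{(2)}_b+2$ and $s_{b-1}(\pi)\neq\pi^{(2)}_b+2$; type $s_3$ ($s_b(\pi)=\pi^{(2)}_b$) if there is a 1-marked $\pi^{(2)}_b$. For $p,t\ge0$, $\mathbb{C}_{<}(k,r|p,t)$ is the set of $\pi\in\mathbb{C}(k,r)$ such that: (1) no odd part is $\ge2t+1$; (2) $\pi^{(2)}_{p+1}<2t+1<\pi^{(2)}_p$; (3) if $\pi^{(2)}_p=2t+2$ it is of starting type $s_2$ or $s_3$; (4) if $\pi^{(2)}_{p+1}=2t$ it is of starting type $s_0$ or $s_1$. For $m\ge0$, $\mathbb{C}_{<}(k,r|m)=\bigcup_{p,t\ge0,\,p+t=m}\mathbb{C}_{<}(k,r|p,t)$. -}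

module Defs where

open import Data.Nat using (ℕ; zero; suc; _+_; _∸_; _≤_; _<_; _%_; _≡ᵇ_; _≤ᵇ_; _<ᵇ_)
open import Data.Nat.Properties using (_≟_)
open import Data.Bool using (Bool; true; false; if_then_else_; not; _∧_; _∨_)
open import Data.List using (List; []; _∷_; length; map; filter; reverse; lookup)
open import Data.List.Membership.Propositional using (_∈_)
open import Data.List.Relation.Unary.All using (All)
open import Data.List.Relation.Unary.Linked using (Linked)
open import Data.Fin using (Fin; toℕ)
open import Data.Maybe using (Maybe; just; nothing)
open import Data.Product using (Σ; _×_; _,_; proj₁; proj₂)
open import Data.Sum using (_⊎_)
open import Data.Unit using (⊤)
open import Data.Empty using (⊥)
open import Relation.Nullary using (¬_)
open import Relation.Binary.PropositionalEquality using (_≡_; _≢_)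

Odd : ℕ → Set
Odd n = n % 2 ≡ 1

Even : ℕ → Set
Even n = n % 2 ≡ 0

oddᵇ : ℕ → Bool
oddᵇ n = n % 2 ≡ᵇ 1

IsPartition : List ℕ → Set
IsPartition π = Linked (λ a b → b ≤ a) π × All (λ a → 0 < a) π

-- 𝔾(k,r)  (written ℂ(k,r) in the paper); parts indexed by Fin (length π),
-- index i here corresponds to π_{i+1}.
InC : ℕ → ℕ → List ℕ → Set
InC k r π =
  IsPartition π
  × (∀ (i j : Fin (length π)) → i ≢ j → lookup π i ≡ lookup π j → ¬ Odd (lookup π i))
  × (∀ (i j : Fin (length π)) → toℕ j ≡ toℕ i + (k ∸ 1) →
       (Even (lookup π i) → lookup π j + 2 < lookup π i)
       × (Odd (lookup π i) → lookup π j + 2 ≤ lookup π i))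
  × length (filter (λ x → x Data.Nat.≤? 2) π) ≤ r ∸ 1

InE : ℕ → ℕ → List ℕ → Set
InE k r π = InC k r π × All Even π

allᵇ : (ℕ → Bool) → List ℕ → Bool
allᵇ P [] = true
allᵇ P (x ∷ xs) = P x ∧ allᵇ P xs

memᵇ : ℕ → List ℕ → Bool
memᵇ j [] = false
memᵇ j (x ∷ xs) = (j ≡ᵇ x) ∨ memᵇ j xs

mexFrom : ℕ → ℕ → List ℕ → ℕ
mexFrom zero j L = j
mexFrom (suc f) j L = if memᵇ j L then mexFrom f (suc j) L else j

mex : List ℕ → ℕ
mex L = mexFrom (length L) 1 L

-- does an already-marked part y (y ≤ x, larger index) block the mark for x?
-- condition: x - y ≤ 2, strict if x odd
blocks : ℕ → ℕ → Bool
blocks x y = if oddᵇ x then (x ∸ y) <ᵇ 2 else (x ∸ y) ≤ᵇ 2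

markOf : List (ℕ × ℕ) → ℕ → ℕ
markOf prev x = mex (map proj₂ (filter (λ p → Data.Bool.T? (blocks x (proj₁ p))) prev))

-- process parts from smallest to largest; accumulator holds (part, mark)
-- pairs of already processed (smaller-or-equal, larger-index) parts.
ggAsc : List (ℕ × ℕ) → List ℕ → List (ℕ × ℕ)
ggAsc acc [] = acc
ggAsc acc (x ∷ xs) = ggAsc ((x , markOf acc x) ∷ acc) xs

-- GG(π): list of (part, mark), in the same order as π (π₁ first)
GG : List ℕ → List (ℕ × ℕ)
GG π = ggAsc [] (reverse π)

-- the j-marked parts π^{(j)}_1 ≥ π^{(j)}_2 ≥ …
marked : ℕ → List ℕ → List ℕ
marked j π = map proj₁ (filter (λ p → proj₂ p Data.Nat.≟ j) (GG π))

N : ℕ → List ℕ → ℕ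
N j π = length (marked j π)

OneM : List ℕ → ℕ → Set
OneM π x = (x , 1) ∈ GG π

nth : {A : Set} → List A → ℕ → Maybe A
nth [] _ = nothing
nth (x ∷ xs) zero = just x
nth (x ∷ xs) (suc i) = nth xs i

-- π^{(2)}_b for 1 ≤ b ≤ N₂
at2 : List ℕ → ℕ → Maybe ℕ
at2 π zero = nothing
at2 π (suc i) = nth (marked 2 π) i

-- Extended values: π^{(2)}_0 = +∞, π^{(2)}_{N₂+1} = -∞.

data ExtN : Set where
  -∞ : ExtN
  fin : ℕ → ExtN
  +∞ : ExtN

data _<ᵉ_ : ExtN → ExtN → Set where
  -∞<fin : ∀ {n} → -∞ <ᵉ fin n
  -∞<+∞ : -∞ <ᵉ +∞
  fin<fin : ∀ {m n} → m < n → fin m <ᵉ fin n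
  fin<+∞ : ∀ {n} → fin n <ᵉ +∞

-- π^{(2)}_b for 0 ≤ b ≤ N₂+1 (nothing = undefined, b > N₂+1)
ext2 : List ℕ → ℕ → Maybe ExtN
ext2 π zero = just +∞
ext2 π (suc i) with at2 π (suc i)
... | just x = just (fin x)
... | nothing = if i ≡ᵇ N 2 π then just -∞ else nothing

okAt : List ℕ → ℕ → Bool
okAt π zero = true
okAt π (suc i) with at2 π (suc i)
... | just x = allᵇ (λ y → not (oddᵇ y ∧ (x ≤ᵇ y))) π
... | nothing = false

largestL : List ℕ → ℕ → ℕ
largestL π zero = zero
largestL π (suc n) = if okAt π (suc n) then suc n else largestL π n

-- l : the largest 0 ≤ l ≤ N₂ with no odd part ≥ π^{(2)}_l
ell : List ℕ → ℕ
ell π = largestL π (N 2 π)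

data SType : Set where
  s0 s1 s2 s3 : SType

-- Start π b τ v : (1 ≤ b ≤ l) π^{(2)}_b is of starting type τ and s_b(π) = v.
Start : List ℕ → ℕ → SType → ℕ → Set
Clause : List ℕ → ℕ → ℕ → SType → ℕ → Set
Guard01 : List ℕ → ℕ → ℕ → Set
Guard2 : List ℕ → ℕ → ℕ → Set

Start π zero τ v = ⊥
Start π (suc b) τ v =
  suc b ≤ ell π × Σ ℕ (λ x → at2 π (suc b) ≡ just x × Clause π b x τ v)

-- Clause π b x τ v : conditions for π^{(2)}_{b+1} = x to have type τ with value v
Clause π b x s0 v = v + 1 ≡ x × OneM π v × Guard01 π b x
Clause π b x s1 v = v + 2 ≡ x × OneM π v × Guard01 π b x
Clause π b x s2 v = v ≡ x + 2 × OneM π (x + 2) × Guard2 π b x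
Clause π b x s3 v = v ≡ x × OneM π x

-- b+1 = 1: π^{(2)}_1 + 2 does not occur;
-- b+1 ≥ 2: whenever a 1-marked x+2 exists, s_b(π) = x + 2
Guard01 π zero x = ¬ ((x + 2) ∈ π)
Guard01 π (suc b) x = OneM π (x + 2) → Σ SType (λ τ → Start π (suc b) τ (x + 2))

-- b+1 ≥ 2: s_b(π) ≠ x + 2
Guard2 π zero x = ⊤
Guard2 π (suc b) x = ¬ Σ SType (λ τ → Start π (suc b) τ (x + 2))

HasType : List ℕ → ℕ → SType → Set
HasType π b τ = Σ ℕ (λ v → Start π b τ v)

InClt : ℕ → ℕ → ℕ → ℕ → List ℕ → Set
InClt k r p t π =
  InC k r π
  × All (λ y → Odd y → y < 2 * t + 1) π
  × Σ ExtN (λ lo → Σ ExtN (λ hi →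
      ext2 π (suc p) ≡ just lo × ext2 π p ≡ just hi
      × lo <ᵉ fin (2 * t + 1) × fin (2 * t + 1) <ᵉ hi))
  × (ext2 π p ≡ just (fin (2 * t + 2)) → HasType π p s2 ⊎ HasType π p s3)
  × (ext2 π (suc p) ≡ just (fin (2 * t)) → HasType π (suc p) s0 ⊎ HasType π (suc p) s1)
  where open Data.Nat using (_*_)

InCltm : ℕ → ℕ → ℕ → List ℕ → Set
InCltm k r m π = Σ ℕ (λ p → Σ ℕ (λ t → p + t ≡ m × InClt k r p t π))

{-# OPTIONS --safe #-}

-- For even π the 2-marked parts π^{(2)}_1 > ⋯ > π^{(2)}_{N₂} are even and pairwise at least 4
-- apart (a part within 2 of a 2-marked part would block mark 2), so π^{(2)}_b ≥ 2(N₂ − b + 1) and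
-- π^{(2)}_{p+1} < 2t + 1 forces N₂ ≤ p + t.  Conversely, if N₂ ≤ m, walk p = 0, 1, … with
-- t = m − p while π^{(2)}_{p+1} > 2t.  The walk stops with π^{(2)}_{p+1} ≤ 2t; in the boundary case
-- π^{(2)}_{p+1} = 2t the starting type of that part picks (p, t) (types s0, s1) or (p + 1, t − 1)
-- (types s2, s3).  A starting type always exists: a 2-marked x is blocked from mark 1 by a
-- 1-marked x or a 1-marked x − 2, and in the second case the guards decide between s1 and s2.

module Submission where

open import Defs
open import Data.Nat
  using (ℕ; zero; suc; _+_; _*_; _∸_; _≤_; _<_; _≥_; z≤n; s≤s; _<ᵇ_; _≤ᵇ_; _≡ᵇ_)
open import Data.Nat.Properties
open import Data.Bool using (true; false; T; T?; not; _∧_; if_then_else_)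
open import Data.Bool.Properties using (T-≡; T-∨)
open import Data.List using (List; []; _∷_; length; map; filter; reverse; _++_; [_])
open import Data.List.Properties using (unfold-reverse; filter-accept; filter-reject)
open import Data.List.Membership.Propositional using (_∈_; _∉_)
open import Data.List.Membership.Propositional.Properties
  using (∈-map⁺; ∈-map⁻; ∈-filter⁺; ∈-filter⁻)
open import Data.List.Relation.Unary.Any using (here; there)
open import Data.List.Relation.Unary.All as All using (All; []; _∷_)
open import Data.List.Relation.Unary.AllPairs using (AllPairs; []; _∷_)
open import Data.List.Relation.Unary.Linked as Linked using (Linked; []; _∷_)
open import Data.List.Relation.Unary.Linked.Properties using (Linked⇒All; AllPairs⇒Linked)
import Data.List.Membership.DecPropositional as DecMembership
open import Data.Maybe using (Maybe; just; nothing)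
open import Data.Maybe.Properties using (just-injective)
open import Data.Product using (Σ; ∃; ∃-syntax; _×_; _,_; proj₁; proj₂)
open import Data.Product.Properties using (≡-dec)
open import Data.Sum as Sum using (_⊎_; inj₁; inj₂; [_,_]′)
open import Data.Unit using (tt)
open import Data.Empty using (⊥-elim)
open import Function using (_∘_)
open import Function.Bundles using (_⇔_; mk⇔; Equivalence)
open import Relation.Nullary using (¬_; Dec; yes; no; _×-dec_; _→-dec_; ¬?; contradiction)
open import Relation.Binary.Definitions using (tri<; tri≈; tri>)
open import Relation.Binary.PropositionalEquality
  using (_≡_; _≢_; refl; sym; trans; cong; subst; module ≡-Reasoning)

open DecMembership _≟_ using (_∈?_)
private module PairMembership = DecMembership (≡-dec _≟_ _≟_)

Even⇒¬Odd : ∀ {n} → Even n → ¬ Odd n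
Even⇒¬Odd e o with trans (sym e) o
... | ()

¬Even1 : ¬ Even 1
¬Even1 ()

even⇒oddᵇ≡false : ∀ {n} → Even n → oddᵇ n ≡ false
even⇒oddᵇ≡false e = cong (_≡ᵇ 1) e

even∧positive⇒2≤ : ∀ {n} → Even n → 0 < n → 2 ≤ n
even∧positive⇒2≤ {1} e _ = ⊥-elim (¬Even1 e)
even∧positive⇒2≤ {suc (suc _)} _ _ = s≤s (s≤s z≤n)

even-near : ∀ {x y} → Even x → Even y → y ≤ x → x ∸ y ≤ 2 → y ≡ x ⊎ y + 2 ≡ x
even-near {0} {0} _ _ _ _ = inj₁ refl
even-near {1} ex _ _ _ = ⊥-elim (¬Even1 ex)
even-near {2} {0} _ _ _ _ = inj₂ refl
even-near {suc (suc (suc _))} {0} _ _ _ (s≤s (s≤s ()))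
even-near {_} {1} _ ey _ _ = ⊥-elim (¬Even1 ey)
even-near {suc (suc x)} {suc (suc y)} ex ey (s≤s (s≤s y≤x)) x∸y≤2 =
  Sum.map (cong (2 +_)) (cong (2 +_)) (even-near ex ey y≤x x∸y≤2)

even-far : ∀ {x y} → Even x → Even y → 3 + y ≤ x → 4 + y ≤ x
even-far {2} {0} _ _ (s≤s (s≤s ()))
even-far {3} {0} ex _ _ = ⊥-elim (¬Even1 ex)
even-far {suc (suc (suc (suc _)))} {0} _ _ _ = s≤s (s≤s (s≤s (s≤s z≤n)))
even-far {_} {1} _ ey _ = ⊥-elim (¬Even1 ey)
even-far {suc (suc x)} {suc (suc y)} ex ey (s≤s (s≤s 3+y≤x)) =
  s≤s (s≤s (even-far ex ey 3+y≤x))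

double-suc : ∀ t → 2 * suc t ≡ 2 * t + 2
double-suc t = trans (*-suc 2 t) (+-comm 2 (2 * t))

double<odd⇒≤ : ∀ {a t} → 2 * a < 2 * t + 1 → a ≤ t
double<odd⇒≤ {a} {t} lt = *-cancelˡ-≤ 2 (m<1+n⇒m≤n (subst (2 * a <_) (+-comm (2 * t) 1) lt))

memᵇ-sound : ∀ {j} L → T (memᵇ j L) → j ∈ L
memᵇ-sound {j} (x ∷ L) t with Equivalence.to T-∨ t
... | inj₁ j≡x = here (≡ᵇ⇒≡ j x j≡x)
... | inj₂ j∈L = there (memᵇ-sound L j∈L)

memᵇ-complete : ∀ {j L} → j ∈ L → T (memᵇ j L)
memᵇ-complete {j} (here refl) = Equivalence.from T-∨ (inj₁ (≡⇒≡ᵇ j j refl))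
memᵇ-complete {j} {x ∷ _} (there j∈L) =
  Equivalence.from (T-∨ {j ≡ᵇ x}) (inj₂ (memᵇ-complete j∈L))

mexFrom-≥ : ∀ fuel j L → j ≤ mexFrom fuel j L
mexFrom-≥ zero j L = ≤-refl
mexFrom-≥ (suc fuel) j L with memᵇ j L
... | true = ≤-trans (n≤1+n j) (mexFrom-≥ fuel (suc j) L)
... | false = ≤-refl

mex≡1 : ∀ {L} → 1 ∉ L → mex L ≡ 1
mex≡1 {[]} _ = refl
mex≡1 {L@(_ ∷ _)} 1∉L with memᵇ 1 L in eq
... | false = refl
... | true = contradiction (memᵇ-sound L (Equivalence.from T-≡ eq)) 1∉L

mex≡2⇒1∈ : ∀ {L} → mex L ≡ 2 → 1 ∈ L
mex≡2⇒1∈ {L} mex≡2 with 1 ∈? L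
... | yes 1∈L = 1∈L
... | no 1∉L with trans (sym (mex≡1 1∉L)) mex≡2
... | ()

length≥2 : ∀ {L : List ℕ} → 1 ∈ L → 2 ∈ L → ∃[ f ] length L ≡ 2 + f
length≥2 {_ ∷ []} (here refl) (here ())
length≥2 {_ ∷ []} (here refl) (there ())
length≥2 {_ ∷ _ ∷ L} _ _ = length L , refl

mexFrom-skip : ∀ fuel {j L} → j ∈ L → mexFrom (suc fuel) j L ≡ mexFrom fuel (suc j) L
mexFrom-skip fuel j∈L rewrite Equivalence.to T-≡ (memᵇ-complete j∈L) = refl

-- With 1 and 2 both present, L has at least two entries, so mex has the fuel to step past 2.
mex≡2⇒2∉ : ∀ {L} → mex L ≡ 2 → 2 ∉ L
mex≡2⇒2∉ {L} mex≡2 2∈L with length≥2 (mex≡2⇒1∈ mex≡2) 2∈L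
... | f , len≡ = <-irrefl (sym mex≡2) (subst (3 ≤_) (sym mex≡mexFrom3) (mexFrom-≥ f 3 L))
  where
  open ≡-Reasoning
  mex≡mexFrom3 : mex L ≡ mexFrom f 3 L
  mex≡mexFrom3 = begin
    mexFrom (length L) 1 L   ≡⟨ cong (λ fuel → mexFrom fuel 1 L) len≡ ⟩
    mexFrom (2 + f) 1 L      ≡⟨ mexFrom-skip (suc f) (mex≡2⇒1∈ mex≡2) ⟩
    mexFrom (suc f) 2 L      ≡⟨ mexFrom-skip f 2∈L ⟩
    mexFrom f 3 L            ∎

ggAsc-++ : ∀ acc xs ys → ggAsc acc (xs ++ ys) ≡ ggAsc (ggAsc acc xs) ys
ggAsc-++ acc [] ys = refl
ggAsc-++ acc (x ∷ xs) ys = ggAsc-++ _ xs ys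

GG-∷ : ∀ x π → GG (x ∷ π) ≡ (x , markOf (GG π) x) ∷ GG π
GG-∷ x π = trans (cong (ggAsc []) (unfold-reverse x π)) (ggAsc-++ [] (reverse π) [ x ])

parts-GG : ∀ π → map proj₁ (GG π) ≡ π
parts-GG [] = refl
parts-GG (x ∷ π) rewrite GG-∷ x π = cong (x ∷_) (parts-GG π)

∈GG⇒∈ : ∀ π {y j} → (y , j) ∈ GG π → y ∈ π
∈GG⇒∈ π {y} m = subst (y ∈_) (parts-GG π) (∈-map⁺ proj₁ m)

∈GG-here : ∀ x π {j} → markOf (GG π) x ≡ j → (x , j) ∈ GG (x ∷ π)
∈GG-here x π refl rewrite GG-∷ x π = here refl

∈GG-there : ∀ x π {y j} → (y , j) ∈ GG π → (y , j) ∈ GG (x ∷ π)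
∈GG-there x π m rewrite GG-∷ x π = there m

∈GG-∷⁻ : ∀ x π {y j} → (y , j) ∈ GG (x ∷ π) →
  (y ≡ x × markOf (GG π) x ≡ j) ⊎ (y , j) ∈ GG π
∈GG-∷⁻ x π m rewrite GG-∷ x π with m
... | here refl = inj₁ (refl , refl)
... | there m′ = inj₂ m′

marked-accept : ∀ {j} x π → markOf (GG π) x ≡ j → marked j (x ∷ π) ≡ x ∷ marked j π
marked-accept {j} x π mark≡j rewrite GG-∷ x π =
  cong (map proj₁) (filter-accept (λ q → proj₂ q ≟ j) mark≡j)

marked-reject : ∀ {j} x π → markOf (GG π) x ≢ j → marked j (x ∷ π) ≡ marked j π
marked-reject {j} x π mark≢j rewrite GG-∷ x π =
  cong (map proj₁) (filter-reject (λ q → proj₂ q ≟ j) mark≢j)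

∈marked⁻ : ∀ {j} π {y} → y ∈ marked j π → (y , j) ∈ GG π
∈marked⁻ {j} π y∈ with ∈-map⁻ proj₁ y∈
... | _ , q∈ , refl with ∈-filter⁻ (λ q → proj₂ q ≟ j) {xs = GG π} q∈
... | q∈GG , refl = q∈GG

blockers : ℕ → List (ℕ × ℕ) → List ℕ
blockers x prev = map proj₂ (filter (λ q → T? (blocks x (proj₁ q))) prev)

∈-blockers⁻ : ∀ {x prev j} → j ∈ blockers x prev → ∃[ y ] (y , j) ∈ prev × T (blocks x y)
∈-blockers⁻ {x} {prev} j∈ with ∈-map⁻ proj₂ j∈
... | (y , _) , q∈ , refl with ∈-filter⁻ (λ q → T? (blocks x (proj₁ q))) {xs = prev} q∈
... | q∈prev , b = y , q∈prev , b

∈-blockers⁺ : ∀ {x prev y j} → (y , j) ∈ prev → T (blocks x y) → j ∈ blockers x prev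
∈-blockers⁺ {x} q∈ b = ∈-map⁺ proj₂ (∈-filter⁺ (λ q → T? (blocks x (proj₁ q))) q∈ b)

blocks-even : ∀ {x y} → Even x → blocks x y ≡ (x ∸ y ≤ᵇ 2)
blocks-even {x} {y} ex =
  cong (λ odd → if odd then x ∸ y <ᵇ 2 else x ∸ y ≤ᵇ 2) (even⇒oddᵇ≡false {x} ex)

module _ {x π} (desc : Linked _≥_ (x ∷ π)) (ev : All Even (x ∷ π)) where

  private
    parts-below : ∀ {y j} → (y , j) ∈ GG π → Even y × y ≤ x
    parts-below m = All.lookup (All.tail ev) (∈GG⇒∈ π m) , All.lookup all≤x (there (∈GG⇒∈ π m))
      where
      all≤x : All (x ≥_) (x ∷ π)
      all≤x = Linked⇒All (λ y≤x z≤y → ≤-trans z≤y y≤x) ≤-refl desc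

  blocker-near : ∀ {y j} → (y , j) ∈ GG π → T (blocks x y) → y ≡ x ⊎ y + 2 ≡ x
  blocker-near {y} m b with parts-below m
  ... | ey , y≤x =
    even-near (All.head ev) ey y≤x (≤ᵇ⇒≤ _ 2 (subst T (blocks-even {x} {y} (All.head ev)) b))

  nonblocker-far : ∀ {y j} → (y , j) ∈ GG π → ¬ T (blocks x y) → 4 + y ≤ x
  nonblocker-far {y} m ¬b with parts-below m
  ... | ey , y≤x = even-far (All.head ev) ey (m≤o∸n⇒m+n≤o 3 y≤x (≰⇒> x∸y≰2))
    where
    x∸y≰2 : ¬ x ∸ y ≤ 2
    x∸y≰2 le = ¬b (subst T (sym (blocks-even {x} {y} (All.head ev))) (≤⇒≤ᵇ le))

2-marked⇒near-1-marked : ∀ {π x} → Linked _≥_ π → All Even π → (x , 2) ∈ GG π →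
  ∃[ y ] (y , 1) ∈ GG π × (y ≡ x ⊎ y + 2 ≡ x)
2-marked⇒near-1-marked {z ∷ π} desc ev x∈ with ∈GG-∷⁻ z π x∈
... | inj₁ (refl , mark≡2) with ∈-blockers⁻ (mex≡2⇒1∈ mark≡2)
...   | y , y∈ , b = y , ∈GG-there z π y∈ , blocker-near desc ev y∈ b
2-marked⇒near-1-marked {z ∷ π} desc ev x∈ | inj₂ x∈′
  with 2-marked⇒near-1-marked (Linked.tail desc) (All.tail ev) x∈′
... | y , y∈ , near = y , ∈GG-there z π y∈ , near

-- A part x + 2 can only be blocked from mark 1 by a 1-marked x + 2 or a 1-marked x.
next-1-marked : ∀ {π x} → Linked _≥_ π → All Even π → x + 2 ∈ π → (x , 1) ∉ GG π →
  (x + 2 , 1) ∈ GG π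
next-1-marked {z ∷ π} {x} desc ev (here refl) x∉ with 1 ∈? blockers (x + 2) (GG π)
... | no 1∉ = ∈GG-here (x + 2) π (mex≡1 1∉)
... | yes 1∈ with ∈-blockers⁻ 1∈
...   | y , y∈ , b with blocker-near desc ev y∈ b
...     | inj₁ refl = ∈GG-there z π y∈
...     | inj₂ y+2≡x+2 = contradiction (∈GG-there z π x₁) x∉
  where
  x₁ : (x , 1) ∈ GG π
  x₁ = subst (λ w → (w , 1) ∈ GG π) (+-cancelʳ-≡ 2 y x y+2≡x+2) y∈
next-1-marked {z ∷ π} desc ev (there x+2∈) x∉ =
  ∈GG-there z π (next-1-marked (Linked.tail desc) (All.tail ev) x+2∈ (x∉ ∘ ∈GG-there z π))

2-marked-spaced : ∀ {π} → Linked _≥_ π → All Even π →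
  AllPairs (λ a b → 4 + b ≤ a) (marked 2 π)
2-marked-spaced {[]} _ _ = []
2-marked-spaced {x ∷ π} desc ev with markOf (GG π) x ≟ 2
... | no mark≢2 rewrite marked-reject x π mark≢2 =
  2-marked-spaced (Linked.tail desc) (All.tail ev)
... | yes mark≡2 rewrite marked-accept x π mark≡2 =
  All.tabulate far ∷ 2-marked-spaced (Linked.tail desc) (All.tail ev)
  where
  far : ∀ {y} → y ∈ marked 2 π → 4 + y ≤ x
  far {y} y∈ = nonblocker-far desc ev y₂ (λ b → mex≡2⇒2∉ mark≡2 (∈-blockers⁺ y₂ b))
    where
    y₂ : (y , 2) ∈ GG π
    y₂ = ∈marked⁻ π y∈

nth-∈ : ∀ {A : Set} (L : List A) i {x} → nth L i ≡ just x → x ∈ L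
nth-∈ (y ∷ L) zero refl = here refl
nth-∈ (y ∷ L) (suc i) e = there (nth-∈ L i e)

nth-just⇒< : ∀ {A : Set} (L : List A) i {x} → nth L i ≡ just x → i < length L
nth-just⇒< (y ∷ L) zero _ = s≤s z≤n
nth-just⇒< (y ∷ L) (suc i) e = s≤s (nth-just⇒< L i e)

nth-length : ∀ {A : Set} (L : List A) → nth L (length L) ≡ nothing
nth-length [] = refl
nth-length (_ ∷ L) = nth-length L

nth-Linked : ∀ {A : Set} {R : A → A → Set} (L : List A) i {x y} → Linked R L →
  nth L i ≡ just x → nth L (suc i) ≡ just y → R x y
nth-Linked (a ∷ b ∷ L) zero (r ∷ _) refl refl = r
nth-Linked (a ∷ L) (suc i) rs e₁ e₂ = nth-Linked L i (Linked.tail rs) e₁ e₂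

head-lowerBound : ∀ {d x} L → d ≤ x → All (d ≤_) L → Linked (λ a b → d + b ≤ a) (x ∷ L) →
  d * suc (length L) ≤ x
head-lowerBound {d} [] d≤x _ _ = subst (_≤ _) (sym (*-identityʳ d)) d≤x
head-lowerBound {d} {x} (y ∷ L) _ (d≤y ∷ ds) (d+y≤x ∷ spaced) = begin
  d * suc (suc (length L))  ≡⟨ *-suc d _ ⟩
  d + d * suc (length L)    ≤⟨ +-monoʳ-≤ d (head-lowerBound L d≤y ds spaced) ⟩
  d + y                     ≤⟨ d+y≤x ⟩
  x                         ∎
  where open ≤-Reasoning

nth-lowerBound : ∀ {d} L i {x} → All (d ≤_) L → Linked (λ a b → d + b ≤ a) L →
  nth L i ≡ just x → d * (length L ∸ i) ≤ x
nth-lowerBound (x ∷ L) zero (d≤x ∷ ds) spaced refl = head-lowerBound L d≤x ds spaced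
nth-lowerBound (_ ∷ L) (suc i) (_ ∷ ds) spaced e = nth-lowerBound L i ds (Linked.tail spaced) e

-- Entry i (from 0) of L followed by -∞; for L = marked 2 π it is π^{(2)}_{i+1}.
data ExtNth (L : List ℕ) (i : ℕ) : ExtN → Set where
  at  : ∀ {x} → nth L i ≡ just x → ExtNth L i (fin x)
  end : i ≡ length L → ExtNth L i -∞

extNth : ∀ L i → i ≤ length L → ∃ (ExtNth L i)
extNth [] zero _ = -∞ , end refl
extNth (x ∷ L) zero _ = fin x , at refl
extNth (x ∷ L) (suc i) (s≤s i≤len) with extNth L i i≤len
... | e , at x≡ = e , at x≡
... | e , end i≡len = e , end (cong suc i≡len)

ExtNth⇒ext2 : ∀ π {i e} → ExtNth (marked 2 π) i e → ext2 π (suc i) ≡ just e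
ExtNth⇒ext2 π {i} (at x≡) with at2 π (suc i) | x≡
... | _ | refl = refl
ExtNth⇒ext2 π (end refl) with at2 π (suc (N 2 π)) | nth-length (marked 2 π)
... | _ | refl rewrite Equivalence.to T-≡ (≡⇒≡ᵇ (N 2 π) (N 2 π) refl) = refl

ext2⇒ExtNth : ∀ π {i e} → ext2 π (suc i) ≡ just e → ExtNth (marked 2 π) i e
ext2⇒ExtNth π {i} e≡ with at2 π (suc i) in x≡
... | just x rewrite just-injective (sym e≡) = at x≡
... | nothing with i ≡ᵇ N 2 π in i≡N
...   | true rewrite just-injective (sym e≡) =
  end (≡ᵇ⇒≡ i (N 2 π) (Equivalence.from T-≡ i≡N))
...   | false with e≡
...     | ()

allᵇ-true : ∀ {P} π → All (λ y → P y ≡ true) π → allᵇ P π ≡ true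
allᵇ-true [] [] = refl
allᵇ-true (y ∷ π) (Py ∷ Pπ) rewrite Py = allᵇ-true π Pπ

okAt-even : ∀ {π} i → All Even π → i < N 2 π → okAt π (suc i) ≡ true
okAt-even {π} i ev i<N with extNth (marked 2 π) i (<⇒≤ i<N)
... | _ , end i≡N = contradiction i≡N (<⇒≢ i<N)
... | fin x , at x≡ with at2 π (suc i) | x≡
... | _ | refl = allᵇ-true π (All.map noOddAbove ev)
  where
  noOddAbove : ∀ {y} → Even y → not (oddᵇ y ∧ (x ≤ᵇ y)) ≡ true
  noOddAbove {y} ey = cong (λ odd → not (odd ∧ (x ≤ᵇ y))) (even⇒oddᵇ≡false {y} ey)

ell≡N₂ : ∀ {π} → All Even π → ell π ≡ N 2 π
ell≡N₂ {π} ev with N 2 π in N≡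
... | zero = refl
... | suc i rewrite okAt-even i ev (≤-reflexive (sym N≡)) = refl

1-marked? : ∀ π v → Dec (OneM π v)
1-marked? π v = (v , 1) PairMembership.∈? GG π

just-∃? : ∀ {A : Set} {P : A → Set} (mx : Maybe A) → (∀ x → Dec (P x)) →
  Dec (∃[ x ] mx ≡ just x × P x)
just-∃? nothing _ = no λ { (_ , () , _) }
just-∃? (just y) P? with P? y
... | yes Py = yes (y , refl , Py)
... | no ¬Py = no λ { (_ , refl , Py) → ¬Py Py }

SType-∃? : ∀ {P : SType → Set} → (∀ τ → Dec (P τ)) → Dec (Σ SType P)
SType-∃? P? with P? s0 | P? s1 | P? s2 | P? s3
... | yes p | _ | _ | _ = yes (s0 , p)
... | _ | yes p | _ | _ = yes (s1 , p)
... | _ | _ | yes p | _ = yes (s2 , p)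
... | _ | _ | _ | yes p = yes (s3 , p)
... | no ¬p0 | no ¬p1 | no ¬p2 | no ¬p3 =
  no λ { (s0 , p) → ¬p0 p ; (s1 , p) → ¬p1 p ; (s2 , p) → ¬p2 p ; (s3 , p) → ¬p3 p }

module _ (π : List ℕ) where
  mutual
    start? : ∀ b τ v → Dec (Start π b τ v)
    start? zero τ v = no λ ()
    start? (suc b) τ v = (suc b ≤? ell π) ×-dec just-∃? (at2 π (suc b)) (λ x → clause? b x τ v)

    clause? : ∀ b x τ v → Dec (Clause π b x τ v)
    clause? b x s0 v = (v + 1 ≟ x) ×-dec (1-marked? π v ×-dec guard01? b x)
    clause? b x s1 v = (v + 2 ≟ x) ×-dec (1-marked? π v ×-dec guard01? b x)
    clause? b x s2 v = (v ≟ x + 2) ×-dec (1-marked? π (x + 2) ×-dec guard2? b x)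
    clause? b x s3 v = (v ≟ x) ×-dec 1-marked? π x

    guard01? : ∀ b x → Dec (Guard01 π b x)
    guard01? zero x = ¬? ((x + 2) ∈? π)
    guard01? (suc b) x = 1-marked? π (x + 2) →-dec someStart? (suc b) (x + 2)

    guard2? : ∀ b x → Dec (Guard2 π b x)
    guard2? zero x = yes tt
    guard2? (suc b) x = ¬? (someStart? (suc b) (x + 2))

    someStart? : ∀ b v → Dec (Σ SType λ τ → Start π b τ v)
    someStart? b v = SType-∃? (λ τ → start? b τ v)

module _ {π} (desc : Linked _≥_ π) (ev : All Even π) where

  s1-or-s2 : ∀ b {x y} → at2 π (suc b) ≡ just x → suc b ≤ ell π →
    ¬ OneM π x → OneM π y → y + 2 ≡ x → HasType π (suc b) s1 ⊎ HasType π (suc b) s2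
  s1-or-s2 zero {x} {y} x≡ b≤ℓ ¬x₁ y₁ y+2≡x with (x + 2) ∈? π
  ... | no x+2∉π = inj₁ (y , b≤ℓ , x , x≡ , y+2≡x , y₁ , x+2∉π)
  ... | yes x+2∈π = inj₂ (x + 2 , b≤ℓ , x , x≡ , refl , next-1-marked desc ev x+2∈π ¬x₁ , tt)
  s1-or-s2 (suc b) {x} {y} x≡ b≤ℓ _ y₁ y+2≡x
    with someStart? π (suc b) (x + 2) | 1-marked? π (x + 2)
  ... | yes s | _ = inj₁ (y , b≤ℓ , x , x≡ , y+2≡x , y₁ , λ _ → s)
  ... | no ¬s | yes x+2₁ = inj₂ (x + 2 , b≤ℓ , x , x≡ , refl , x+2₁ , ¬s)
  ... | no _ | no ¬x+2₁ =
    inj₁ (y , b≤ℓ , x , x≡ , y+2≡x , y₁ , λ x+2₁ → contradiction x+2₁ ¬x+2₁)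

  startType : ∀ b {x} → at2 π (suc b) ≡ just x → suc b ≤ ell π →
    (HasType π (suc b) s0 ⊎ HasType π (suc b) s1) ⊎ (HasType π (suc b) s2 ⊎ HasType π (suc b) s3)
  startType b {x} x≡ b≤ℓ with 1-marked? π x
  ... | yes x₁ = inj₂ (inj₂ (x , b≤ℓ , x , x≡ , refl , x₁))
  ... | no ¬x₁ with 2-marked⇒near-1-marked desc ev (∈marked⁻ π (nth-∈ (marked 2 π) b x≡))
  ...   | y , y₁ , inj₁ refl = contradiction y₁ ¬x₁
  ...   | y , y₁ , inj₂ y+2≡x =
    [ inj₁ ∘ inj₂ , inj₂ ∘ inj₁ ]′ (s1-or-s2 b x≡ b≤ℓ ¬x₁ y₁ y+2≡x)

<ᵉ⇒≢ : ∀ {a b} → a <ᵉ b → a ≢ b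
<ᵉ⇒≢ (fin<fin m<n) refl = <-irrefl refl m<n

fin-≤-<ᵉ : ∀ {a b e} → a ≤ b → fin b <ᵉ e → fin a <ᵉ e
fin-≤-<ᵉ a≤b (fin<fin b<c) = fin<fin (≤-<-trans a≤b b<c)
fin-≤-<ᵉ _ fin<+∞ = fin<+∞

<ᵉ-fin-≤ : ∀ {e a b} → e <ᵉ fin a → a ≤ b → e <ᵉ fin b
<ᵉ-fin-≤ -∞<fin _ = -∞<fin
<ᵉ-fin-≤ (fin<fin c<a) a≤b = fin<fin (<-≤-trans c<a a≤b)

2t+1<2t+2 : ∀ t → 2 * t + 1 < 2 * t + 2
2t+1<2t+2 t = +-monoʳ-< (2 * t) (n<1+n 1)

module _ {k r : ℕ} {π : List ℕ} (π∈E : InE k r π) where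

  private
    π∈C : InC k r π
    π∈C = proj₁ π∈E

    desc : Linked _≥_ π
    desc = proj₁ (proj₁ π∈C)

    ev : All Even π
    ev = proj₂ π∈E

    D : List ℕ
    D = marked 2 π

    2≤D : All (2 ≤_) D
    2≤D = All.tabulate λ y∈ → 2≤part (∈GG⇒∈ π (∈marked⁻ π y∈))
      where
      2≤part : ∀ {y} → y ∈ π → 2 ≤ y
      2≤part y∈π = even∧positive⇒2≤ (All.lookup ev y∈π) (All.lookup (proj₂ (proj₁ π∈C)) y∈π)

    D-spaced : Linked (λ a b → 4 + b ≤ a) D
    D-spaced = AllPairs⇒Linked (2-marked-spaced desc ev)

    noOdd : ∀ t → All (λ y → Odd y → y < 2 * t + 1) π
    noOdd t = All.map (λ {y} ey oy → contradiction oy (Even⇒¬Odd {y} ey)) ev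

  N₂-bounded : ∀ {p t} → InClt k r p t π → N 2 π ≤ p + t
  N₂-bounded {p} {t} (_ , _ , (_ , _ , lo≡ , _ , lo<2t+1 , _) , _)
    with ext2⇒ExtNth π lo≡ | lo<2t+1
  ... | end p≡N | _ = subst (_≤ p + t) p≡N (m≤m+n p t)
  ... | at x≡ | fin<fin x<2t+1 = ≤-trans (m≤n+m∸n (N 2 π) p) (+-monoʳ-≤ p N∸p≤t)
    where
    D-2spaced : Linked (λ a b → 2 + b ≤ a) D
    D-2spaced = Linked.map (λ {_} {b} → ≤-trans (+-monoˡ-≤ b (s≤s (s≤s z≤n)))) D-spaced

    N∸p≤t : N 2 π ∸ p ≤ t
    N∸p≤t = double<odd⇒≤ (≤-<-trans (nth-lowerBound D p 2≤D D-2spaced x≡) x<2t+1)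

  Above : ℕ → ℕ → Set
  Above p t = ∃[ hi ] ext2 π p ≡ just hi × fin (2 * t + 2) <ᵉ hi

  Below : ℕ → ℕ → Set
  Below p t = ∃[ lo ] ext2 π (suc p) ≡ just lo × lo <ᵉ fin (2 * t)

  above⇒≢ : ∀ p t → Above p t → ext2 π p ≢ just (fin (2 * t + 2))
  above⇒≢ _ _ (_ , hi≡ , above) e = <ᵉ⇒≢ above (just-injective (trans (sym e) hi≡))

  below⇒≢ : ∀ p t → Below p t → ext2 π (suc p) ≢ just (fin (2 * t))
  below⇒≢ _ _ (_ , lo≡ , below) e = <ᵉ⇒≢ below (just-injective (trans (sym lo≡) e))

  inClt-between : ∀ p t → Above p t → Below p t → InClt k r p t π
  inClt-between p t a@(hi , hi≡ , above) b@(lo , lo≡ , below) =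
    π∈C , noOdd t ,
    (lo , hi , lo≡ , hi≡ ,
     <ᵉ-fin-≤ below (m≤m+n (2 * t) 1) , fin-≤-<ᵉ (<⇒≤ (2t+1<2t+2 t)) above) ,
    (λ e → ⊥-elim (above⇒≢ p t a e)) , (λ e → ⊥-elim (below⇒≢ p t b e))

  inClt-s01 : ∀ p t → Above p t → ext2 π (suc p) ≡ just (fin (2 * t)) →
    HasType π (suc p) s0 ⊎ HasType π (suc p) s1 → InClt k r p t π
  inClt-s01 p t a@(hi , hi≡ , above) lo≡ s01 =
    π∈C , noOdd t ,
    (fin (2 * t) , hi , lo≡ , hi≡ ,
     fin<fin (m<m+n (2 * t) (s≤s z≤n)) , fin-≤-<ᵉ (<⇒≤ (2t+1<2t+2 t)) above) ,
    (λ e → ⊥-elim (above⇒≢ p t a e)) , λ _ → s01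

  inClt-s23 : ∀ p t → ext2 π p ≡ just (fin (2 * t + 2)) → HasType π p s2 ⊎ HasType π p s3 →
    Below p t → InClt k r p t π
  inClt-s23 p t hi≡ s23 b@(lo , lo≡ , below) =
    π∈C , noOdd t ,
    (lo , fin (2 * t + 2) , lo≡ , hi≡ ,
     <ᵉ-fin-≤ below (m≤m+n (2 * t) 1) , fin<fin (2t+1<2t+2 t)) ,
    (λ _ → s23) , (λ e → ⊥-elim (below⇒≢ p t b e))

  below-end : ∀ p t → p ≡ N 2 π → Below p t
  below-end p t p≡N = -∞ , ExtNth⇒ext2 π (end p≡N) , -∞<fin

  below-next : ∀ p t → nth D p ≡ just (2 * t + 2) → Below (suc p) t
  below-next p t d≡ with extNth D (suc p) (nth-just⇒< D p d≡)
  ... | _ , end p+1≡N = below-end (suc p) t p+1≡N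
  ... | fin z , at z≡ = fin z , ExtNth⇒ext2 π (at z≡) , fin<fin (≤-trans (n≤1+n _) 2+z≤2t)
    where
    2+z≤2t : 2 + z ≤ 2 * t
    2+z≤2t = +-cancelˡ-≤ 2 _ _
      (subst (4 + z ≤_) (+-comm (2 * t) 2) (nth-Linked D p D-spaced d≡ z≡))

  module _ {m} (N₂≤m : N 2 π ≤ m) where

    search : ∀ p t → p + t ≡ m → p ≤ N 2 π → Above p t → InCltm k r m π
    search p zero p+0≡m p≤N above =
      p , zero , p+0≡m , inClt-between p zero above (below-end p zero p≡N)
      where
      p≡N : p ≡ N 2 π
      p≡N = ≤-antisym p≤N (≤-trans N₂≤m (≤-reflexive (trans (sym p+0≡m) (+-identityʳ p))))
    search p (suc t) p+t≡m p≤N above with extNth D p p≤N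
    ... | -∞ , end p≡N =
      p , suc t , p+t≡m , inClt-between p (suc t) above (below-end p (suc t) p≡N)
    ... | fin d , at d≡ with <-cmp d (2 * suc t)
    ...   | tri< d<2t _ _ =
      p , suc t , p+t≡m ,
      inClt-between p (suc t) above (fin d , ExtNth⇒ext2 π (at d≡) , fin<fin d<2t)
    ...   | tri> _ _ 2t<d =
      search (suc p) t (trans (sym (+-suc p t)) p+t≡m) (nth-just⇒< D p d≡)
        (fin d , ExtNth⇒ext2 π (at d≡) , fin<fin (subst (_< d) (double-suc t) 2t<d))
    ...   | tri≈ _ d≡2t _
      with startType desc ev p d≡ (subst (suc p ≤_) (sym (ell≡N₂ ev)) (nth-just⇒< D p d≡))
    ...     | inj₁ s01 =
      p , suc t , p+t≡m ,
      inClt-s01 p (suc t) above (ExtNth⇒ext2 π (at (trans d≡ (cong just d≡2t)))) s01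
    ...     | inj₂ s23 =
      suc p , t , trans (sym (+-suc p t)) p+t≡m ,
      inClt-s23 (suc p) t (ExtNth⇒ext2 π (at d≡′)) s23 (below-next p t d≡′)
      where
      d≡′ : nth D p ≡ just (2 * t + 2)
      d≡′ = trans d≡ (cong just (trans d≡2t (double-suc t)))

  N₂≤m⇒InCltm : ∀ {m} → N 2 π ≤ m → InCltm k r m π
  N₂≤m⇒InCltm N₂≤m = search N₂≤m 0 _ refl z≤n (+∞ , refl , fin<+∞)

theorem5p3 : (k r m N₂ : ℕ) (π : List ℕ) → 3 ≤ r → r ≤ k →
    InE k r π → N 2 π ≡ N₂ → (InCltm k r m π ⇔ N₂ ≤ m)
theorem5p3 k r m _ π _ _ π∈E refl = mk⇔
  (λ { (p , t , refl , π∈Clt) → N₂-bounded {k} {r} π∈E π∈Clt })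
  (N₂≤m⇒InCltm {k} {r} π∈E)
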